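{- Let $M,N$ be non-deterministic $\lambda$-terms with $M\rightsquigarrow N$, and let $u\in\Delta$. If $\mathcal T(N)\cap\uparrow u$ is infinite, then $\mathcal T(M)\cap\uparrow u$ is infinite.
   Context: Non-deterministic $\lambda$-terms are given by $M::=x\mid\lambda x.M\mid (M)N\mid M+N$, taken up to $\alpha$-equivalence and the identities $M+N=N+M$, $(M+N)+P=M+(N+P)$, $\lambda x.(M+N)=\lambda x.M+\lambda x.N$, $(M+N)P=(M)P+(N)P$. $\beta$-reduction is the contextual closure of $(\lambda x.M)N\to_\beta M[N/x]$. Let $\sqsubseteq$ be the least partial order such that $M\sqsubseteq M+N$ and $N\sqsubseteq M+N$, and such that $M\sqsubseteq N$ implies $M+P\sqsubseteq N+P$, $\lambda x.M\sqsubseteq\lambda x.N$, $(M)P\sqsubseteq(N)P$ and $(P)M\sqsubseteq(P)N$. Partial reduction: $M\rightsquigarrow N$ iff there is $P$ with $M\to_\beta P$ and $N\sqsubseteq P$. Resource terms $\Delta$ are given by $s::=x\mid\lambda x.s\mid\langle s\rangle\bar t$, with bags finite multisets; $a^!$ is the set of bags with elements in $a$. The Taylor support is defined by: - $\mathcal T(x)=\{x\}$; - $\mathcal T(\lambda x.M)=\{\lambda x.s:s\in\mathcal T(M)\}$; - $\mathcal T((M)N)=\{\langle s\rangle\bar t:s\in\mathcal T(M),\bar t\in\mathcal T(N)^!\}$; - $\mathcal T(M+N)=\mathcal T(M)\cup\mathcal T(N)$. Resource reduction $\to_r$ acts on finite formal sums with natural coefficients. It is generated by $\langle\lambda x.t\rangle[s_1,\dots,s_n]\to_r\sum_{f\in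 S_n}t[s_{f(1)}/x_1,\dots,s_{f(n)}/x_n]$ when $x_1,\dots,x_n$ are exactly the free occurrences of $x$ in $t$, and $\to_r0$ otherwise. It is closed under constructors (extended linearly) and linearity. Write $s\ge t$ if $s\to_r^*a$ with $t$ in the support of $a$. $\uparrow u=\{s\in\Delta:s\ge u\}$. -}

module Defs where

open import Data.Nat using (ℕ; zero; suc; pred; _+_; _<ᵇ_; _≟_)
open import Data.Nat.Properties using (<-cmp)
open import Data.Bool using (if_then_else_)
open import Data.List using (List; []; _∷_; [_]; map; concatMap; _++_; length)
open import Data.List.Relation.Unary.Any using (Any)
open import Data.List.Relation.Unary.All using (All)
open import Data.Product using (Σ; _×_; _,_; ∃)
open import Data.Sum using (_⊎_)
open import Data.Empty using (⊥)
open import Relation.Nullary using (¬_; yes; no)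
open import Relation.Binary.PropositionalEquality using (_≡_)
open import Relation.Binary.Definitions using (tri<; tri≈; tri>)

-- Non-deterministic λ-terms (de Bruijn indices: α-equivalence is syntactic
-- equality).  The identities of the calculus are handled by an explicit
-- congruence _≈_ below; all relations on terms are taken modulo _≈_.

infixl 6 _⊕_

data Λ : Set where
  var : ℕ → Λ
  lam : Λ → Λ
  app : Λ → Λ → Λ
  _⊕_ : Λ → Λ → Λ

shiftΛ : ℕ → ℕ → Λ → Λ
shiftΛ c k (var i) = if i <ᵇ c then var i else var (i + k)
shiftΛ c k (lam M) = lam (shiftΛ (suc c) k M)
shiftΛ c k (app M N) = app (shiftΛ c k M) (shiftΛ c k N)
shiftΛ c k (M ⊕ N) = shiftΛ c k M ⊕ shiftΛ c k N

-- substΛ k N M : substitute N for the variable bound k binders up,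
-- decrementing the variables above it.  M [N/x] = substΛ 0 N M.
substΛ : ℕ → Λ → Λ → Λ
substΛ k N (var i) with <-cmp i k
... | tri< _ _ _ = var i
... | tri≈ _ _ _ = shiftΛ 0 k N
... | tri> _ _ _ = var (pred i)
substΛ k N (lam M) = lam (substΛ (suc k) N M)
substΛ k N (app M P) = app (substΛ k N M) (substΛ k N P)
substΛ k N (M ⊕ P) = substΛ k N M ⊕ substΛ k N P

infix 4 _≈_
data _≈_ : Λ → Λ → Set where
  ≈-refl  : ∀ {M} → M ≈ M
  ≈-sym   : ∀ {M N} → M ≈ N → N ≈ M
  ≈-trans : ∀ {M N P} → M ≈ N → N ≈ P → M ≈ P
  ≈-comm  : ∀ {M N} → M ⊕ N ≈ N ⊕ M
  ≈-assoc : ∀ {M N P} → (M ⊕ N) ⊕ P ≈ M ⊕ (N ⊕ P)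
  ≈-lam⊕  : ∀ {M N} → lam (M ⊕ N) ≈ lam M ⊕ lam N
  ≈-app⊕  : ∀ {M N P} → app (M ⊕ N) P ≈ app M P ⊕ app N P
  ≈-lam   : ∀ {M N} → M ≈ N → lam M ≈ lam N
  ≈-appˡ  : ∀ {M N P} → M ≈ N → app M P ≈ app N P
  ≈-appʳ  : ∀ {M N P} → M ≈ N → app P M ≈ app P N
  ≈-⊕ˡ    : ∀ {M N P} → M ≈ N → M ⊕ P ≈ N ⊕ P
  ≈-⊕ʳ    : ∀ {M N P} → M ≈ N → P ⊕ M ≈ P ⊕ N

infix 4 _→β₀_
data _→β₀_ : Λ → Λ → Set where
  β     : ∀ {M N} → app (lam M) N →β₀ substΛ 0 N M
  ξ-lam : ∀ {M N} → M →β₀ N → lam M →β₀ lam N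
  ξ-appˡ : ∀ {M N P} → M →β₀ N → app M P →β₀ app N P
  ξ-appʳ : ∀ {M N P} → M →β₀ N → app P M →β₀ app P N
  ξ-⊕ˡ  : ∀ {M N P} → M →β₀ N → M ⊕ P →β₀ N ⊕ P
  ξ-⊕ʳ  : ∀ {M N P} → M →β₀ N → P ⊕ M →β₀ P ⊕ N

infix 4 _→β_
_→β_ : Λ → Λ → Set
M →β P = Σ Λ λ M′ → Σ Λ λ P′ → M ≈ M′ × M′ →β₀ P′ × P′ ≈ P

infix 4 _⊑_
data _⊑_ : Λ → Λ → Set where
  ⊑-≈     : ∀ {M N} → M ≈ N → M ⊑ N
  ⊑-trans : ∀ {M N P} → M ⊑ N → N ⊑ P → M ⊑ P
  ⊑-inl   : ∀ {M N} → M ⊑ M ⊕ N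
  ⊑-inr   : ∀ {M N} → N ⊑ M ⊕ N
  ⊑-⊕     : ∀ {M N P} → M ⊑ N → M ⊕ P ⊑ N ⊕ P
  ⊑-lam   : ∀ {M N} → M ⊑ N → lam M ⊑ lam N
  ⊑-appˡ  : ∀ {M N P} → M ⊑ N → app M P ⊑ app N P
  ⊑-appʳ  : ∀ {M N P} → M ⊑ N → app P M ⊑ app P N

infix 4 _⇝_
_⇝_ : Λ → Λ → Set
M ⇝ N = Σ Λ λ P → M →β P × N ⊑ P

-- Resource terms (de Bruijn); bags are lists taken up to permutation
-- (see _≃_ below).

data Δ : Set where
  rvar : ℕ → Δ
  rlam : Δ → Δ
  rapp : Δ → List Δ → Δ

mutual
  infix 4 _≃_ _≃ᵇ_
  data _≃_ : Δ → Δ → Set where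
    ≃-refl  : ∀ {s} → s ≃ s
    ≃-sym   : ∀ {s t} → s ≃ t → t ≃ s
    ≃-trans : ∀ {s t u} → s ≃ t → t ≃ u → s ≃ u
    ≃-lam   : ∀ {s t} → s ≃ t → rlam s ≃ rlam t
    ≃-app   : ∀ {s t b c} → s ≃ t → b ≃ᵇ c → rapp s b ≃ rapp t c

  data _≃ᵇ_ : List Δ → List Δ → Set where
    ≃ᵇ-nil   : [] ≃ᵇ []
    ≃ᵇ-cons  : ∀ {s t b c} → s ≃ t → b ≃ᵇ c → (s ∷ b) ≃ᵇ (t ∷ c)
    ≃ᵇ-swap  : ∀ {s t b} → (s ∷ t ∷ b) ≃ᵇ (t ∷ s ∷ b)
    ≃ᵇ-trans : ∀ {b c d} → b ≃ᵇ c → c ≃ᵇ d → b ≃ᵇ d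

T : Λ → Δ → Set
T (var x) (rvar y) = x ≡ y
T (lam M) (rlam s) = T M s
T (app M N) (rapp s b) = T M s × All (T N) b
T (M ⊕ N) s = T M s ⊎ T N s
T _ _ = ⊥

mutual
  shift : ℕ → ℕ → Δ → Δ
  shift c k (rvar i) = if i <ᵇ c then rvar i else rvar (i + k)
  shift c k (rlam s) = rlam (shift (suc c) k s)
  shift c k (rapp s b) = rapp (shift c k s) (shiftᵇ c k b)

  shiftᵇ : ℕ → ℕ → List Δ → List Δ
  shiftᵇ c k [] = []
  shiftᵇ c k (s ∷ b) = shift c k s ∷ shiftᵇ c k b

mutual
  occ : ℕ → Δ → ℕ
  occ k (rvar i) with i ≟ k
  ... | yes _ = 1
  ... | no _ = 0
  occ k (rlam s) = occ (suc k) s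
  occ k (rapp s b) = occ k s + occᵇ k b

  occᵇ : ℕ → List Δ → ℕ
  occᵇ k [] = 0
  occᵇ k (s ∷ b) = occ k s + occᵇ k b

-- linear substitution: the successive free occurrences of variable k
-- (in left-to-right order) are replaced by the successive elements of
-- the list; the remaining list is returned.
mutual
  lsub : ℕ → Δ → List Δ → Δ × List Δ
  lsub k (rvar i) σ with <-cmp i k
  ... | tri< _ _ _ = rvar i , σ
  ... | tri> _ _ _ = rvar (pred i) , σ
  lsub k (rvar i) [] | tri≈ _ _ _ = rvar i , []
  lsub k (rvar i) (s ∷ σ) | tri≈ _ _ _ = shift 0 k s , σ
  lsub k (rlam t) σ with lsub (suc k) t σ
  ... | t′ , σ′ = rlam t′ , σ′
  lsub k (rapp t b) σ with lsub k t σ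
  ... | t′ , σ₁ with lsubᵇ k b σ₁
  ... | b′ , σ₂ = rapp t′ b′ , σ₂

  lsubᵇ : ℕ → List Δ → List Δ → List Δ × List Δ
  lsubᵇ k [] σ = [] , σ
  lsubᵇ k (t ∷ b) σ with lsub k t σ
  ... | t′ , σ₁ with lsubᵇ k b σ₁
  ... | b′ , σ₂ = (t′ ∷ b′) , σ₂

linsubst : Δ → List Δ → Δ
linsubst t σ with lsub 0 t σ
... | t′ , _ = t′

-- all permutations of a list (n! of them, with multiplicity): S_n acting
insertions : {A : Set} → A → List A → List (List A)
insertions x [] = [ x ∷ [] ]
insertions x (y ∷ ys) = (x ∷ y ∷ ys) ∷ map (y ∷_) (insertions x ys)

perms : {A : Set} → List A → List (List A)
perms [] = [ [] ]
perms (x ∷ xs) = concatMap (insertions x) (perms xs)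

-- result of firing ⟨λx.t⟩[s₁,…,sₙ]; finite sums with natural coefficients
-- are represented as lists (multiplicity = coefficient; [] = 0)
fire : Δ → List Δ → List Δ
fire t b with occ 0 t ≟ length b
... | yes _ = map (linsubst t) (perms b)
... | no _ = []

infix 4 _⟶_
data _⟶_ : Δ → List Δ → Set where
  r-β    : ∀ {t b} → rapp (rlam t) b ⟶ fire t b
  r-lam  : ∀ {s a} → s ⟶ a → rlam s ⟶ map rlam a
  r-appˡ : ∀ {s a b} → s ⟶ a → rapp s b ⟶ map (λ s′ → rapp s′ b) a
  r-appʳ : ∀ {s t a b₁ b₂} → t ⟶ a →
           rapp s (b₁ ++ t ∷ b₂) ⟶ map (λ t′ → rapp s (b₁ ++ t′ ∷ b₂)) a

infix 4 _⟶ₛ_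
data _⟶ₛ_ : List Δ → List Δ → Set where
  r-lin : ∀ {s a c₁ c₂} → s ⟶ a → (c₁ ++ s ∷ c₂) ⟶ₛ (c₁ ++ a ++ c₂)

infix 4 _⟶*_
data _⟶*_ : List Δ → List Δ → Set where
  ⟶*-refl : ∀ {a} → a ⟶* a
  ⟶*-conv : ∀ {a b c} → a ≃ᵇ b → b ⟶* c → a ⟶* c
  ⟶*-step : ∀ {a b c} → a ⟶ₛ b → b ⟶* c → a ⟶* c

infix 4 _≥_
_≥_ : Δ → Δ → Set
s ≥ t = Σ (List Δ) λ a → [ s ] ⟶* a × Any (_≃ t) a

↑ : Δ → Δ → Set
↑ u s = s ≥ u

Finite : (Δ → Set) → Set
Finite P = Σ (List Δ) λ L → ∀ s → P s → Any (s ≃_) L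

Infinite : (Δ → Set) → Set
Infinite P = ¬ Finite P

-- Write M ≈ M′ →β₀ P′ ≈ P ⊒ N. Every s ∈ T(N) lies in T(P′), and inverting the step through
-- the Taylor expansion (the redex (λx.t)Q expands to ⟨λx.t⟩σ, whose firing contains t⟨σ/x⟩)
-- gives an antecedent s′ ∈ T(M) reducing to a sum that contains s; hence s ≥ u implies s′ ≥ u.
-- Moreover s is among finitely many explicit reducts of s′, and ≃-classes of resource terms
-- are finite, so a finite cover of T(M) ∩ ↑u yields a finite cover of T(N) ∩ ↑u.

module Submission where

open import Defs
open import Data.Nat using (ℕ; suc; pred; _+_; _<_; _<ᵇ_; _≟_)
open import Data.Nat.Properties using (<-cmp)
open import Data.Bool using (true; false; if_then_else_)
open import Data.Empty using (⊥; ⊥-elim)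
open import Data.List using (List; []; _∷_; [_]; map; concatMap; _++_; length)
open import Data.List.Properties using (++-assoc; ++-identityʳ; length-++; map-++)
open import Data.List.Relation.Unary.Any as Any using (Any; here; there)
open import Data.List.Relation.Unary.Any.Properties using (++⁺ˡ; ++⁺ʳ)
open import Data.List.Relation.Unary.All as All using (All; []; _∷_)
open import Data.List.Relation.Unary.All.Properties using (++⁺)
open import Data.List.Relation.Binary.Pointwise using (Pointwise; []; _∷_)
open import Data.List.Membership.Propositional using (_∈_; find; lose)
open import Data.List.Membership.Propositional.Properties
  using (∈-map⁺; ∈-map⁻; ∈-concatMap⁺; ∈-concatMap⁻; ∈-∃++)
open import Data.List.Relation.Binary.Subset.Propositional using (_⊆_)
open import Data.List.Relation.Binary.Permutation.Propositional
  using (_↭_; ↭-refl; ↭-sym; ↭-trans; prep; swap)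
open import Data.List.Relation.Binary.Permutation.Propositional.Properties
  using (∈-resp-↭; drop-mid)
open import Data.List.Relation.Binary.BagAndSetEquality
  using (_∼[_]_; set; [_]-Equality; map-cong; >>=-cong)
open import Data.Product as Product using (Σ; _×_; _,_; ∃)
open import Data.Product.Function.NonDependent.Propositional using (_×-⇔_)
open import Data.Sum as Sum using (inj₁; inj₂)
open import Data.Sum.Function.Propositional using (_⊎-⇔_)
open import Function.Base using (_∘_)
open import Function.Bundles using (_⇔_; mk⇔; Equivalence)
open import Function.Construct.Composition using (_⇔-∘_)
open import Function.Construct.Identity using (⇔-id)
open import Function.Construct.Symmetry using (⇔-sym)
open import Function.Properties.Inverse using (↔⇒⇔)
open import Function.Related.TypeIsomorphisms using (×-distribʳ-⊎)
open import Relation.Binary.Bundles using (Setoid)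
open import Relation.Binary.Definitions using (tri<; tri≈; tri>)
open import Relation.Binary.PropositionalEquality
  using (_≡_; _≢_; refl; sym; trans; cong; cong₂; subst; subst₂)
open import Relation.Nullary using (yes; no; contradiction)

open Equivalence using (to; from)

∈-concatMap⁺′ : ∀ {A B : Set} (f : A → List B) {xs x y} → x ∈ xs → y ∈ f x → y ∈ concatMap f xs
∈-concatMap⁺′ f x∈xs y∈fx = ∈-concatMap⁺ f (lose x∈xs y∈fx)

∈-concatMap⁻′ : ∀ {A B : Set} (f : A → List B) xs {y} → y ∈ concatMap f xs →
                ∃ λ x → x ∈ xs × y ∈ f x
∈-concatMap⁻′ f xs p = find (∈-concatMap⁻ f p)

module _ {A : Set} where

  insertions-↭ : ∀ {a : A} ys {xs} → xs ∈ insertions a ys → xs ↭ a ∷ ys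
  insertions-↭ []       (here refl) = ↭-refl
  insertions-↭ (y ∷ ys) (here refl) = ↭-refl
  insertions-↭ {a} (y ∷ ys) (there p) with ∈-map⁻ (y ∷_) p
  ... | xs , q , refl = ↭-trans (prep y (insertions-↭ ys q)) (swap y a ↭-refl)

  ∈-insertions : ∀ {a : A} xs ys → xs ++ a ∷ ys ∈ insertions a (xs ++ ys)
  ∈-insertions []       []       = here refl
  ∈-insertions []       (y ∷ ys) = here refl
  ∈-insertions (x ∷ xs) ys       = there (∈-map⁺ (x ∷_) (∈-insertions xs ys))

  perms-↭ : ∀ ys {xs : List A} → xs ∈ perms ys → xs ↭ ys
  perms-↭ []       (here refl) = ↭-refl
  perms-↭ (y ∷ ys) p with ∈-concatMap⁻′ (insertions y) (perms ys) p
  ... | zs , q , r = ↭-trans (insertions-↭ zs r) (prep y (perms-↭ ys q))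

  ↭⇒∈-perms : ∀ (ys : List A) {xs} → xs ↭ ys → xs ∈ perms ys
  ↭⇒∈-perms []       {[]}    p = here refl
  ↭⇒∈-perms []       {x ∷ _} p with () ← ∈-resp-↭ p (here refl)
  ↭⇒∈-perms (y ∷ ys) p with ∈-∃++ (∈-resp-↭ (↭-sym p) (here refl))
  ... | xs₁ , xs₂ , refl =
    ∈-concatMap⁺′ (insertions y) (↭⇒∈-perms ys (drop-mid xs₁ [] p)) (∈-insertions xs₁ xs₂)

-- Finiteness of ≃-classes

-- A finite list containing the whole ≃-class of a term (see ≃⇒∈-variants).
mutual
  variants : Δ → List Δ
  variants (rvar i)   = [ rvar i ]
  variants (rlam s)   = map rlam (variants s)
  variants (rapp s b) = concatMap (λ s′ → map (rapp s′) (variantsᵇ b)) (variants s)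

  variantsˡ : List Δ → List (List Δ)
  variantsˡ []      = [ [] ]
  variantsˡ (s ∷ b) = concatMap (λ s′ → map (s′ ∷_) (variantsˡ b)) (variants s)

  variantsᵇ : List Δ → List (List Δ)
  variantsᵇ b = concatMap perms (variantsˡ b)

∈-variantsᵇ⁺ : ∀ b {b′ c} → c ∈ variantsˡ b → b′ ↭ c → b′ ∈ variantsᵇ b
∈-variantsᵇ⁺ b c∈ b′↭c = ∈-concatMap⁺′ perms c∈ (↭⇒∈-perms _ b′↭c)

∈-variantsᵇ⁻ : ∀ b {b′} → b′ ∈ variantsᵇ b → ∃ λ c → c ∈ variantsˡ b × b′ ↭ c
∈-variantsᵇ⁻ b p with ∈-concatMap⁻′ perms (variantsˡ b) p
... | c , c∈ , q = c , c∈ , perms-↭ c q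

∈-variantsˡ-∷⁺ : ∀ s b {s′ b′} → s′ ∈ variants s → b′ ∈ variantsˡ b → s′ ∷ b′ ∈ variantsˡ (s ∷ b)
∈-variantsˡ-∷⁺ s b s′∈ b′∈ = ∈-concatMap⁺′ (λ x → map (x ∷_) (variantsˡ b)) s′∈ (∈-map⁺ (_ ∷_) b′∈)

∈-variantsˡ-∷⁻ : ∀ s b {c} → c ∈ variantsˡ (s ∷ b) →
                 ∃ λ s′ → ∃ λ b′ → c ≡ s′ ∷ b′ × s′ ∈ variants s × b′ ∈ variantsˡ b
∈-variantsˡ-∷⁻ s b p with ∈-concatMap⁻′ (λ x → map (x ∷_) (variantsˡ b)) (variants s) p
... | s′ , s′∈ , q with ∈-map⁻ (s′ ∷_) q
... | b′ , b′∈ , refl = s′ , b′ , refl , s′∈ , b′∈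

mutual
  ∈-variants : ∀ s → s ∈ variants s
  ∈-variants (rvar i)   = here refl
  ∈-variants (rlam s)   = ∈-map⁺ rlam (∈-variants s)
  ∈-variants (rapp s b) = ∈-concatMap⁺′ (λ s′ → map (rapp s′) (variantsᵇ b)) (∈-variants s)
                            (∈-map⁺ (rapp s) (∈-variantsᵇ⁺ b (∈-variantsˡ b) ↭-refl))

  ∈-variantsˡ : ∀ b → b ∈ variantsˡ b
  ∈-variantsˡ []      = here refl
  ∈-variantsˡ (s ∷ b) = ∈-variantsˡ-∷⁺ s b (∈-variants s) (∈-variantsˡ b)

variantsᵇ-∷-⊆ : ∀ {s t b c} → variants s ⊆ variants t → variantsᵇ b ⊆ variantsᵇ c →
                variantsᵇ (s ∷ b) ⊆ variantsᵇ (t ∷ c)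
variantsᵇ-∷-⊆ {s} {t} {b} {c} s⊆t b⊆c p with ∈-variantsᵇ⁻ (s ∷ b) p
... | _ , q , x↭ with ∈-variantsˡ-∷⁻ s b q
... | s′ , b′ , refl , s′∈ , b′∈ with ∈-variantsᵇ⁻ c (b⊆c (∈-variantsᵇ⁺ b b′∈ ↭-refl))
... | c′ , c′∈ , b′↭c′ =
  ∈-variantsᵇ⁺ (t ∷ c) (∈-variantsˡ-∷⁺ t c (s⊆t s′∈) c′∈) (↭-trans x↭ (prep s′ b′↭c′))

variantsᵇ-swap-⊆ : ∀ {s t b} → variantsᵇ (s ∷ t ∷ b) ⊆ variantsᵇ (t ∷ s ∷ b)
variantsᵇ-swap-⊆ {s} {t} {b} p with ∈-variantsᵇ⁻ (s ∷ t ∷ b) p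
... | _ , q , x↭ with ∈-variantsˡ-∷⁻ s (t ∷ b) q
... | s′ , _ , refl , s′∈ , r with ∈-variantsˡ-∷⁻ t b r
... | t′ , b′ , refl , t′∈ , b′∈ =
  ∈-variantsᵇ⁺ (t ∷ s ∷ b) (∈-variantsˡ-∷⁺ t (s ∷ b) t′∈ (∈-variantsˡ-∷⁺ s b s′∈ b′∈))
    (↭-trans x↭ (swap s′ t′ ↭-refl))

module SetEq {A : Set} = Setoid ([ set ]-Equality A)

mutual
  ≃⇒variants-∼ : ∀ {s t} → s ≃ t → variants s ∼[ set ] variants t
  ≃⇒variants-∼ ≃-refl          = SetEq.refl
  ≃⇒variants-∼ (≃-sym e)       = SetEq.sym (≃⇒variants-∼ e)
  ≃⇒variants-∼ (≃-trans e e′)  = SetEq.trans (≃⇒variants-∼ e) (≃⇒variants-∼ e′)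
  ≃⇒variants-∼ (≃-lam e)       = map-cong (λ _ → refl) (≃⇒variants-∼ e)
  ≃⇒variants-∼ (≃-app e bc)    =
    >>=-cong (≃⇒variants-∼ e) (λ _ → map-cong (λ _ → refl) (≃ᵇ⇒variantsᵇ-∼ bc))

  ≃ᵇ⇒variantsᵇ-∼ : ∀ {b c} → b ≃ᵇ c → variantsᵇ b ∼[ set ] variantsᵇ c
  ≃ᵇ⇒variantsᵇ-∼ ≃ᵇ-nil          = SetEq.refl
  ≃ᵇ⇒variantsᵇ-∼ (≃ᵇ-cons {s} {t} {b} {c} e bc) = mk⇔
    (variantsᵇ-∷-⊆ {s} {t} {b} {c} (to (≃⇒variants-∼ e)) (to (≃ᵇ⇒variantsᵇ-∼ bc)))
    (variantsᵇ-∷-⊆ {t} {s} {c} {b} (from (≃⇒variants-∼ e)) (from (≃ᵇ⇒variantsᵇ-∼ bc)))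
  ≃ᵇ⇒variantsᵇ-∼ (≃ᵇ-swap {s} {t} {b}) =
    mk⇔ (variantsᵇ-swap-⊆ {s} {t} {b}) (variantsᵇ-swap-⊆ {t} {s} {b})
  ≃ᵇ⇒variantsᵇ-∼ (≃ᵇ-trans e e′) = SetEq.trans (≃ᵇ⇒variantsᵇ-∼ e) (≃ᵇ⇒variantsᵇ-∼ e′)

≃⇒∈-variants : ∀ {s t} → s ≃ t → s ∈ variants t
≃⇒∈-variants {s} e = to (≃⇒variants-∼ e) (∈-variants s)

All-⇔ : ∀ {P Q : Δ → Set} → (∀ s → P s ⇔ Q s) → ∀ {b} → All P b ⇔ All Q b
All-⇔ P⇔Q = mk⇔ (All.map (to (P⇔Q _))) (All.map (from (P⇔Q _)))

⊥⇔⊥⊎⊥ : ⊥ ⇔ (⊥ Sum.⊎ ⊥)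
⊥⇔⊥⊎⊥ = mk⇔ ⊥-elim Sum.[ ⊥-elim , ⊥-elim ]

T-resp-≈ : ∀ {M N} → M ≈ N → ∀ s → T M s ⇔ T N s
T-resp-≈ ≈-refl                s          = ⇔-id _
T-resp-≈ (≈-sym e)             s          = ⇔-sym (T-resp-≈ e s)
T-resp-≈ (≈-trans e e′)        s          = T-resp-≈ e′ s ⇔-∘ T-resp-≈ e s
T-resp-≈ ≈-comm                s          = mk⇔ Sum.swap Sum.swap
T-resp-≈ ≈-assoc               s          = mk⇔ Sum.assocʳ Sum.assocˡ
T-resp-≈ ≈-lam⊕                (rvar _)   = ⊥⇔⊥⊎⊥
T-resp-≈ ≈-lam⊕                (rlam s)   = ⇔-id _
T-resp-≈ ≈-lam⊕                (rapp _ _) = ⊥⇔⊥⊎⊥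
T-resp-≈ ≈-app⊕                (rvar _)   = ⊥⇔⊥⊎⊥
T-resp-≈ ≈-app⊕                (rlam _)   = ⊥⇔⊥⊎⊥
T-resp-≈ ≈-app⊕                (rapp s b) = ↔⇒⇔ ×-distribʳ-⊎
T-resp-≈ (≈-lam e)             (rvar _)   = ⇔-id _
T-resp-≈ (≈-lam e)             (rlam s)   = T-resp-≈ e s
T-resp-≈ (≈-lam e)             (rapp _ _) = ⇔-id _
T-resp-≈ (≈-appˡ e)            (rvar _)   = ⇔-id _
T-resp-≈ (≈-appˡ e)            (rlam _)   = ⇔-id _
T-resp-≈ (≈-appˡ e)            (rapp s b) = T-resp-≈ e s ×-⇔ ⇔-id _
T-resp-≈ (≈-appʳ e)            (rvar _)   = ⇔-id _
T-resp-≈ (≈-appʳ e)            (rlam _)   = ⇔-id _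
T-resp-≈ (≈-appʳ e)            (rapp s b) = ⇔-id _ ×-⇔ All-⇔ (T-resp-≈ e)
T-resp-≈ (≈-⊕ˡ e)              s          = T-resp-≈ e s ⊎-⇔ ⇔-id _
T-resp-≈ (≈-⊕ʳ e)              s          = ⇔-id _ ⊎-⇔ T-resp-≈ e s

T-mono-⊑ : ∀ {M N} → M ⊑ N → ∀ s → T M s → T N s
T-mono-⊑ (⊑-≈ e)        s          = to (T-resp-≈ e s)
T-mono-⊑ (⊑-trans p q)  s          = T-mono-⊑ q s ∘ T-mono-⊑ p s
T-mono-⊑ ⊑-inl          s          = inj₁
T-mono-⊑ ⊑-inr          s          = inj₂
T-mono-⊑ (⊑-⊕ p)        s          = Sum.map₁ (T-mono-⊑ p s)
T-mono-⊑ (⊑-lam p)      (rlam s)   = T-mono-⊑ p s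
T-mono-⊑ (⊑-appˡ p)     (rapp s b) = Product.map₁ (T-mono-⊑ p s)
T-mono-⊑ (⊑-appʳ p)     (rapp s b) = Product.map₂ (All.map (T-mono-⊑ p _))

mutual
  T-shiftΛ⁻ : ∀ c k N s → T (shiftΛ c k N) s → ∃ λ s₀ → T N s₀ × shift c k s₀ ≡ s
  T-shiftΛ⁻ c k (var i) s h with i <ᵇ c in i<ᵇc
  T-shiftΛ⁻ c k (var i) (rvar _) refl | true  =
    rvar i , refl , cong (λ b → if b then rvar i else rvar (i + k)) i<ᵇc
  T-shiftΛ⁻ c k (var i) (rvar _) refl | false =
    rvar i , refl , cong (λ b → if b then rvar i else rvar (i + k)) i<ᵇc
  T-shiftΛ⁻ c k (lam N) (rlam s) h with T-shiftΛ⁻ (suc c) k N s h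
  ... | s₀ , h₀ , refl = rlam s₀ , h₀ , refl
  T-shiftΛ⁻ c k (app N P) (rapp s b) (h , hb) with T-shiftΛ⁻ c k N s h | T-shiftΛᵇ⁻ c k P b hb
  ... | s₀ , h₀ , refl | b₀ , hb₀ , refl = rapp s₀ b₀ , (h₀ , hb₀) , refl
  T-shiftΛ⁻ c k (N ⊕ P) s (inj₁ h) with T-shiftΛ⁻ c k N s h
  ... | s₀ , h₀ , e = s₀ , inj₁ h₀ , e
  T-shiftΛ⁻ c k (N ⊕ P) s (inj₂ h) with T-shiftΛ⁻ c k P s h
  ... | s₀ , h₀ , e = s₀ , inj₂ h₀ , e

  T-shiftΛᵇ⁻ : ∀ c k N b → All (T (shiftΛ c k N)) b → ∃ λ b₀ → All (T N) b₀ × shiftᵇ c k b₀ ≡ b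
  T-shiftΛᵇ⁻ c k N []      []       = [] , [] , refl
  T-shiftΛᵇ⁻ c k N (s ∷ b) (h ∷ hb) with T-shiftΛ⁻ c k N s h | T-shiftΛᵇ⁻ c k N b hb
  ... | s₀ , h₀ , refl | b₀ , hb₀ , refl = s₀ ∷ b₀ , h₀ ∷ hb₀ , refl

occ-≢ : ∀ {i k} → i ≢ k → occ k (rvar i) ≡ 0
occ-≢ {i} {k} i≢k with i ≟ k
... | yes i≡k = contradiction i≡k i≢k
... | no _    = refl

occ-self : ∀ k → occ k (rvar k) ≡ 1
occ-self k with k ≟ k
... | yes _   = refl
... | no k≢k  = contradiction refl k≢k

lsub-< : ∀ {i k} ρ → i < k → lsub k (rvar i) ρ ≡ (rvar i , ρ)
lsub-< {i} {k} ρ i<k with <-cmp i k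
... | tri< _ _ _    = refl
... | tri≈ i≮k _ _  = contradiction i<k i≮k
... | tri> i≮k _ _  = contradiction i<k i≮k

lsub-> : ∀ {i k} ρ → k < i → lsub k (rvar i) ρ ≡ (rvar (pred i) , ρ)
lsub-> {i} {k} ρ k<i with <-cmp i k
... | tri< _ _ k≮i  = contradiction k<i k≮i
... | tri≈ _ _ k≮i  = contradiction k<i k≮i
... | tri> _ _ _    = refl

lsub-self : ∀ k s ρ → lsub k (rvar k) (s ∷ ρ) ≡ (shift 0 k s , ρ)
lsub-self k s ρ with <-cmp k k
... | tri< _ k≢k _  = contradiction refl k≢k
... | tri≈ _ _ _    = refl
... | tri> _ k≢k _  = contradiction refl k≢k

lsub-rlam : ∀ k t σ {s ρ} → lsub (suc k) t σ ≡ (s , ρ) → lsub k (rlam t) σ ≡ (rlam s , ρ)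
lsub-rlam k t σ eq rewrite eq = refl

lsub-rapp : ∀ k t b σ {σ′ s c ρ} → lsub k t σ ≡ (s , σ′) → lsubᵇ k b σ′ ≡ (c , ρ) →
            lsub k (rapp t b) σ ≡ (rapp s c , ρ)
lsub-rapp k t b σ eq eqᵇ rewrite eq | eqᵇ = refl

lsubᵇ-∷ : ∀ k t b σ {σ′ s c ρ} → lsub k t σ ≡ (s , σ′) → lsubᵇ k b σ′ ≡ (c , ρ) →
          lsubᵇ k (t ∷ b) σ ≡ (s ∷ c , ρ)
lsubᵇ-∷ k t b σ eq eqᵇ rewrite eq | eqᵇ = refl

-- s is t⟨σ/k⟩ for some t ∈ T(M) and σ ∈ T(N)^! matching the occurrences of k in t;
-- the arbitrary tail ρ lets the substitution be threaded through an application.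
record SubstPreimage (k : ℕ) (N M : Λ) (s : Δ) : Set where
  constructor substPreimage
  field
    {body} : Δ
    {bag}  : List Δ
    body∈T : T M body
    bag∈T  : All (T N) bag
    occ≡   : occ k body ≡ length bag
    lsub≡  : ∀ ρ → lsub k body (bag ++ ρ) ≡ (s , ρ)

record SubstPreimageᵇ (k : ℕ) (N M : Λ) (c : List Δ) : Set where
  constructor substPreimageᵇ
  field
    {body} : List Δ
    {bag}  : List Δ
    body∈T : All (T M) body
    bag∈T  : All (T N) bag
    occ≡   : occᵇ k body ≡ length bag
    lsub≡  : ∀ ρ → lsubᵇ k body (bag ++ ρ) ≡ (c , ρ)

mutual
  T-substΛ⁻ : ∀ k N M s → T (substΛ k N M) s → SubstPreimage k N M s
  T-substΛ⁻ k N (var i) s h with <-cmp i k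
  T-substΛ⁻ k N (var i) (rvar _) refl | tri< i<k i≢k _ =
    substPreimage refl [] (occ-≢ i≢k) (λ ρ → lsub-< ρ i<k)
  T-substΛ⁻ k N (var i) s h | tri≈ _ refl _ with T-shiftΛ⁻ 0 k N s h
  ... | s₀ , h₀ , refl = substPreimage refl (h₀ ∷ []) (occ-self i) (lsub-self i s₀)
  T-substΛ⁻ k N (var i) (rvar _) refl | tri> _ i≢k k<i =
    substPreimage refl [] (occ-≢ i≢k) (λ ρ → lsub-> ρ k<i)
  T-substΛ⁻ k N (lam M) (rlam s) h with T-substΛ⁻ (suc k) N M s h
  ... | substPreimage {t} {σ} ht hσ occ≡ lsub≡ =
    substPreimage {body = rlam t} ht hσ occ≡ (λ ρ → lsub-rlam k t (σ ++ ρ) (lsub≡ ρ))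
  T-substΛ⁻ k N (app M P) (rapp s c) (h , hc) with T-substΛ⁻ k N M s h | T-substΛᵇ⁻ k N P c hc
  ... | substPreimage {t} {σ} ht hσ occ≡ lsub≡ | substPreimageᵇ {b} {τ} hb hτ occᵇ≡ lsubᵇ≡ =
    substPreimage {body = rapp t b} (ht , hb) (++⁺ hσ hτ)
      (trans (cong₂ _+_ occ≡ occᵇ≡) (sym (length-++ σ)))
      (λ ρ → subst (λ σ′ → lsub k (rapp t b) σ′ ≡ (rapp s c , ρ)) (sym (++-assoc σ τ ρ))
               (lsub-rapp k t b (σ ++ τ ++ ρ) (lsub≡ (τ ++ ρ)) (lsubᵇ≡ ρ)))
  T-substΛ⁻ k N (M ⊕ P) s (inj₁ h) with T-substΛ⁻ k N M s h
  ... | substPreimage ht hσ occ≡ lsub≡ = substPreimage (inj₁ ht) hσ occ≡ lsub≡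
  T-substΛ⁻ k N (M ⊕ P) s (inj₂ h) with T-substΛ⁻ k N P s h
  ... | substPreimage ht hσ occ≡ lsub≡ = substPreimage (inj₂ ht) hσ occ≡ lsub≡

  T-substΛᵇ⁻ : ∀ k N M c → All (T (substΛ k N M)) c → SubstPreimageᵇ k N M c
  T-substΛᵇ⁻ k N M []      []       = substPreimageᵇ [] [] refl (λ _ → refl)
  T-substΛᵇ⁻ k N M (s ∷ c) (h ∷ hc) with T-substΛ⁻ k N M s h | T-substΛᵇ⁻ k N M c hc
  ... | substPreimage {t} {σ} ht hσ occ≡ lsub≡ | substPreimageᵇ {b} {τ} hb hτ occᵇ≡ lsubᵇ≡ =
    substPreimageᵇ {body = t ∷ b} (ht ∷ hb) (++⁺ hσ hτ)
      (trans (cong₂ _+_ occ≡ occᵇ≡) (sym (length-++ σ)))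
      (λ ρ → subst (λ σ′ → lsubᵇ k (t ∷ b) σ′ ≡ (s ∷ c , ρ)) (sym (++-assoc σ τ ρ))
               (lsubᵇ-∷ k t b (σ ++ τ ++ ρ) (lsub≡ (τ ++ ρ)) (lsubᵇ≡ ρ)))

-- Resource reduction in context

≃ᵇ-refl : ∀ b → b ≃ᵇ b
≃ᵇ-refl []      = ≃ᵇ-nil
≃ᵇ-refl (s ∷ b) = ≃ᵇ-cons ≃-refl (≃ᵇ-refl b)

≃ᵇ-++ˡ : ∀ c {a b} → a ≃ᵇ b → c ++ a ≃ᵇ c ++ b
≃ᵇ-++ˡ []      a≃b = a≃b
≃ᵇ-++ˡ (s ∷ c) a≃b = ≃ᵇ-cons ≃-refl (≃ᵇ-++ˡ c a≃b)

≃ᵇ-++ʳ : ∀ c {a b} → a ≃ᵇ b → a ++ c ≃ᵇ b ++ c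
≃ᵇ-++ʳ c ≃ᵇ-nil          = ≃ᵇ-refl c
≃ᵇ-++ʳ c (≃ᵇ-cons e a≃b) = ≃ᵇ-cons e (≃ᵇ-++ʳ c a≃b)
≃ᵇ-++ʳ c ≃ᵇ-swap         = ≃ᵇ-swap
≃ᵇ-++ʳ c (≃ᵇ-trans p q)  = ≃ᵇ-trans (≃ᵇ-++ʳ c p) (≃ᵇ-++ʳ c q)

⟶*-trans : ∀ {a b c} → a ⟶* b → b ⟶* c → a ⟶* c
⟶*-trans ⟶*-refl       q = q
⟶*-trans (⟶*-conv e p) q = ⟶*-conv e (⟶*-trans p q)
⟶*-trans (⟶*-step r p) q = ⟶*-step r (⟶*-trans p q)

⟶*-frame : ∀ c₁ c₂ {a b} → a ⟶* b → c₁ ++ a ++ c₂ ⟶* c₁ ++ b ++ c₂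
⟶*-frame c₁ c₂ ⟶*-refl       = ⟶*-refl
⟶*-frame c₁ c₂ (⟶*-conv e p) = ⟶*-conv (≃ᵇ-++ˡ c₁ (≃ᵇ-++ʳ c₂ e)) (⟶*-frame c₁ c₂ p)
⟶*-frame c₁ c₂ (⟶*-step (r-lin {s} {a} {d₁} {d₂} r) p) =
  ⟶*-step (subst₂ _⟶ₛ_ (reassoc [ s ]) (reassoc a) (r-lin {c₁ = c₁ ++ d₁} {c₂ = d₂ ++ c₂} r))
          (⟶*-frame c₁ c₂ p)
  where
  reassoc : ∀ x → (c₁ ++ d₁) ++ x ++ d₂ ++ c₂ ≡ c₁ ++ (d₁ ++ x ++ d₂) ++ c₂
  reassoc x = trans (++-assoc c₁ d₁ (x ++ d₂ ++ c₂))
                (cong (c₁ ++_) (sym (trans (++-assoc d₁ (x ++ d₂) c₂)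
                                           (cong (d₁ ++_) (++-assoc x d₂ c₂)))))

record ReductionContext (F : Δ → Δ) : Set where
  field
    ⟶-cong : ∀ {s a} → s ⟶ a → F s ⟶ map F a
    ≃-cong : ∀ {s t} → s ≃ t → F s ≃ F t

  ≃ᵇ-cong : ∀ {a b} → a ≃ᵇ b → map F a ≃ᵇ map F b
  ≃ᵇ-cong ≃ᵇ-nil          = ≃ᵇ-nil
  ≃ᵇ-cong (≃ᵇ-cons e a≃b) = ≃ᵇ-cons (≃-cong e) (≃ᵇ-cong a≃b)
  ≃ᵇ-cong ≃ᵇ-swap         = ≃ᵇ-swap
  ≃ᵇ-cong (≃ᵇ-trans p q)  = ≃ᵇ-trans (≃ᵇ-cong p) (≃ᵇ-cong q)

  ⟶*-cong : ∀ {a b} → a ⟶* b → map F a ⟶* map F b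
  ⟶*-cong ⟶*-refl       = ⟶*-refl
  ⟶*-cong (⟶*-conv e p) = ⟶*-conv (≃ᵇ-cong e) (⟶*-cong p)
  ⟶*-cong (⟶*-step (r-lin {s} {a} {d₁} {d₂} r) p) =
    ⟶*-step (subst₂ _⟶ₛ_ (sym (map-++ F d₁ (s ∷ d₂)))
                         (sym (trans (map-++ F d₁ (a ++ d₂)) (cong (map F d₁ ++_) (map-++ F a d₂))))
                         (r-lin {c₁ = map F d₁} {c₂ = map F d₂} (⟶-cong r)))
            (⟶*-cong p)

rlam-context : ReductionContext rlam
rlam-context = record { ⟶-cong = r-lam ; ≃-cong = ≃-lam }

rapp-head-context : ∀ b → ReductionContext (λ s → rapp s b)
rapp-head-context b = record { ⟶-cong = r-appˡ ; ≃-cong = λ e → ≃-app e (≃ᵇ-refl b) }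

rapp-bag-context : ∀ s b₁ b₂ → ReductionContext (λ t → rapp s (b₁ ++ t ∷ b₂))
rapp-bag-context s b₁ b₂ = record
  { ⟶-cong = r-appʳ ; ≃-cong = λ e → ≃-app ≃-refl (≃ᵇ-++ˡ b₁ (≃ᵇ-cons e (≃ᵇ-refl b₂))) }

infix 4 _↠_
_↠_ : Δ → Δ → Set
s ↠ t = Σ (List Δ) λ a → [ s ] ⟶* a × t ∈ a

↠-refl : ∀ s → s ↠ s
↠-refl s = [ s ] , ⟶*-refl , here refl

⟶⇒↠ : ∀ {s a t} → s ⟶ a → t ∈ a → s ↠ t
⟶⇒↠ {a = a} r t∈a = a ++ [] , ⟶*-step (r-lin {c₁ = []} {c₂ = []} r) ⟶*-refl , ++⁺ˡ t∈a

↠-extend : ∀ {P : Δ → Set} {s t b} → s ↠ t → [ t ] ⟶* b → Any P b →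
           Σ (List Δ) λ c → [ s ] ⟶* c × Any P c
↠-extend (a , s⟶*a , t∈a) t⟶*b pb with ∈-∃++ t∈a
... | a₁ , a₂ , refl = _ , ⟶*-trans s⟶*a (⟶*-frame a₁ a₂ t⟶*b) , ++⁺ʳ a₁ (++⁺ˡ pb)

↠-trans : ∀ {s t u} → s ↠ t → t ↠ u → s ↠ u
↠-trans s↠t (b , t⟶*b , u∈b) = ↠-extend s↠t t⟶*b u∈b

↠-≥-trans : ∀ {s t u} → s ↠ t → t ≥ u → s ≥ u
↠-≥-trans s↠t (b , t⟶*b , u∈b) = ↠-extend s↠t t⟶*b u∈b

↠-cong : ∀ {F} → ReductionContext F → ∀ {s t} → s ↠ t → F s ↠ F t
↠-cong {F} ctx (a , s⟶*a , t∈a) = map F a , ReductionContext.⟶*-cong ctx s⟶*a , ∈-map⁺ F t∈a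

↠-bag : ∀ s b₁ {xs ys} → Pointwise _↠_ xs ys → rapp s (b₁ ++ xs) ↠ rapp s (b₁ ++ ys)
↠-bag s b₁ []                      = ↠-refl _
↠-bag s b₁ {x ∷ xs} {y ∷ ys} (x↠y ∷ xs↠ys) =
  ↠-trans (↠-cong (rapp-bag-context s b₁ xs) x↠y)
    (subst₂ (λ c c′ → rapp s c ↠ rapp s c′) (++-assoc b₁ [ y ] xs) (++-assoc b₁ [ y ] ys)
      (↠-bag s (b₁ ++ [ y ]) xs↠ys))

-- Antecedents along a β-step

-- For a step d : M →β₀ P, a finite list containing every element of T(P) that comes from a
-- given element of T(M) (see T-→β₀⁻).
mutual
  reducts : ∀ {M P} → M →β₀ P → Δ → List Δ
  reducts d s = s ∷ stepReducts d s

  stepReducts : ∀ {M P} → M →β₀ P → Δ → List Δ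
  stepReducts β          (rapp (rlam t) b) = fire t b
  stepReducts (ξ-lam d)  (rlam s)          = map rlam (reducts d s)
  stepReducts (ξ-appˡ d) (rapp s b)        = map (λ s′ → rapp s′ b) (reducts d s)
  stepReducts (ξ-appʳ d) (rapp s b)        = map (rapp s) (reductsᵇ d b)
  stepReducts (ξ-⊕ˡ d)   s                 = reducts d s
  stepReducts (ξ-⊕ʳ d)   s                 = reducts d s
  stepReducts _          _                 = []

  reductsᵇ : ∀ {M P} → M →β₀ P → List Δ → List (List Δ)
  reductsᵇ d []      = [ [] ]
  reductsᵇ d (s ∷ b) = concatMap (λ s′ → map (s′ ∷_) (reductsᵇ d b)) (reducts d s)

∈-fire : ∀ {t σ s ρ} → occ 0 t ≡ length σ → lsub 0 t σ ≡ (s , ρ) → s ∈ fire t σ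
∈-fire {t} {σ} {s} {ρ} occ≡ lsub≡ with occ 0 t ≟ length σ
... | no occ≢ = contradiction occ≡ occ≢
... | yes _   = subst (_∈ map (linsubst t) (perms σ)) (linsubst≡ lsub≡)
                  (∈-map⁺ (linsubst t) (↭⇒∈-perms σ ↭-refl))
  where
  linsubst≡ : lsub 0 t σ ≡ (s , ρ) → linsubst t σ ≡ s
  linsubst≡ eq rewrite eq = refl

record Antecedent {M P} (d : M →β₀ P) (s : Δ) : Set where
  constructor antecedent
  field
    {source}  : Δ
    source∈T  : T M source
    source↠   : source ↠ s
    ∈-reducts : s ∈ reducts d source

record Antecedentᵇ {M P} (d : M →β₀ P) (b : List Δ) : Set where
  constructor antecedentᵇ
  field
    {source}   : List Δ
    source∈T   : All (T M) source
    source↠    : Pointwise _↠_ source b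
    ∈-reductsᵇ : b ∈ reductsᵇ d source

mutual
  T-→β₀⁻ : ∀ {M P} (d : M →β₀ P) s → T P s → Antecedent d s
  T-→β₀⁻ (β {M} {N}) s h with T-substΛ⁻ 0 N M s h
  ... | substPreimage {t} {σ} ht hσ occ≡ lsub≡ =
    antecedent (ht , hσ) (⟶⇒↠ r-β s∈fire) (there s∈fire)
    where
    s∈fire : s ∈ fire t σ
    s∈fire = ∈-fire {t} {σ} occ≡
               (subst (λ σ′ → lsub 0 t σ′ ≡ (s , [])) (++-identityʳ σ) (lsub≡ []))
  T-→β₀⁻ (ξ-lam d) (rlam s) h with T-→β₀⁻ d s h
  ... | antecedent hs s′↠s m = antecedent hs (↠-cong rlam-context s′↠s) (there (∈-map⁺ rlam m))
  T-→β₀⁻ (ξ-appˡ d) (rapp s b) (h , hb) with T-→β₀⁻ d s h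
  ... | antecedent hs s′↠s m =
    antecedent (hs , hb) (↠-cong (rapp-head-context b) s′↠s) (there (∈-map⁺ (λ s′ → rapp s′ b) m))
  T-→β₀⁻ (ξ-appʳ d) (rapp s b) (h , hb) with T-→β₀⁻ᵇ d b hb
  ... | antecedentᵇ hb′ b′↠b m = antecedent (h , hb′) (↠-bag s [] b′↠b) (there (∈-map⁺ (rapp s) m))
  T-→β₀⁻ (ξ-⊕ˡ d) s (inj₁ h) with T-→β₀⁻ d s h
  ... | antecedent hs s′↠s m = antecedent (inj₁ hs) s′↠s (there m)
  T-→β₀⁻ (ξ-⊕ˡ d) s (inj₂ h) = antecedent (inj₂ h) (↠-refl s) (here refl)
  T-→β₀⁻ (ξ-⊕ʳ d) s (inj₁ h) = antecedent (inj₁ h) (↠-refl s) (here refl)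
  T-→β₀⁻ (ξ-⊕ʳ d) s (inj₂ h) with T-→β₀⁻ d s h
  ... | antecedent hs s′↠s m = antecedent (inj₂ hs) s′↠s (there m)

  T-→β₀⁻ᵇ : ∀ {M P} (d : M →β₀ P) b → All (T P) b → Antecedentᵇ d b
  T-→β₀⁻ᵇ d []      []       = antecedentᵇ [] [] (here refl)
  T-→β₀⁻ᵇ d (s ∷ b) (h ∷ hb) with T-→β₀⁻ d s h | T-→β₀⁻ᵇ d b hb
  ... | antecedent {s′} hs s′↠s m | antecedentᵇ {b′} hb′ b′↠b mb =
    antecedentᵇ (hs ∷ hb′) (s′↠s ∷ b′↠b)
      (∈-concatMap⁺′ (λ x → map (x ∷_) (reductsᵇ d b′)) m (∈-map⁺ (s ∷_) mb))

Finite⇒∈-cover : ∀ {P} → Finite P → Σ (List Δ) λ K → ∀ s → P s → s ∈ K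
Finite⇒∈-cover {P} (L , L-covers) = concatMap variants L , covers
  where
  covers : ∀ s → P s → s ∈ concatMap variants L
  covers s p with find (L-covers s p)
  ... | l , l∈L , s≃l = ∈-concatMap⁺′ variants l∈L (≃⇒∈-variants s≃l)

⇝-Finite : ∀ {M N} → M ⇝ N → ∀ u →
           Finite (λ s → T M s × ↑ u s) → Finite (λ s → T N s × ↑ u s)
⇝-Finite {N = N} (P , (M′ , P′ , M≈M′ , d , P′≈P) , N⊑P) u finite with Finite⇒∈-cover finite
... | K , K-covers = concatMap (reducts d) K , covers
  where
  covers : ∀ s → T N s × s ≥ u → Any (s ≃_) (concatMap (reducts d) K)
  covers s (hN , s≥u) with T-→β₀⁻ d s (from (T-resp-≈ P′≈P s) (T-mono-⊑ N⊑P s hN))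
  ... | antecedent {s′} hs s′↠s s∈ =
    Any.map (λ { refl → ≃-refl })
      (∈-concatMap⁺′ (reducts d) (K-covers s′ (from (T-resp-≈ M≈M′ s′) hs , ↠-≥-trans s′↠s s≥u))
        s∈)

lemma5 : (M N : Λ) → M ⇝ N → (u : Δ) →
         Infinite (λ s → T N s × ↑ u s) → Infinite (λ s → T M s × ↑ u s)
lemma5 M N M⇝N u infinite = infinite ∘ ⇝-Finite M⇝N u
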